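{- Let $q$ be a power of an odd prime, $n\ge1$, $l\in\{1,2\}$, $a\in\mathbf{F}_q$, and let $\alpha\in\mathbf{F}_q^{4n}$ satisfy $\alpha\times\alpha^1=0$ and $\alpha\times\alpha^2=0$. Then for all $\phi,\psi\in\mathbf{F}_q^{4n}$ and every subspace $N$ of $\mathbf{F}_q^{4n}$: (i) the map $\phi\mapsto\phi*_{l,a}\alpha$ is a bijection of $\mathbf{F}_q^{4n}$; (ii) $\langle\phi*_{l,a}\alpha,\ \psi*_{l,a}\alpha^l\rangle=\langle\phi,\psi\rangle$; (iii) $(N*_{l,a}\alpha)^{\perp}=N^{\perp}*_{l,a}\alpha^l$.
   Context: Elements of $\mathbf{F}_q^{4n}$ are written $\phi=(X,Y,Z,T)$ with $X,Y,Z,T\in\mathbf{F}_q^n$. For $u,v\in\mathbf{F}_q^n$, $u\times v$ is the coordinatewise product, extended blockwise to $\mathbf{F}_q^{4n}$: $(X,Y,Z,T)\times(X',Y',Z',T')=(X\times X',Y\times Y',Z\times Z',T\times T')$. The symmetric bilinear form on $\mathbf{F}_q^{4n}$ is $\langle(X,Y,Z,T),(X',Y',Z',T')\rangle=\langle X,X'\rangle-\langle Y,Y'\rangle+\langle Z,Z'\rangle-\langle T,T'\rangle$, where $\langle X,X'\rangle=\sum_i X_iX'_i$; $\perp$ denotes orthogonal complement with respect to it. For $\phi=(X,Y,Z,T)$ set $\phi^1=(-Z,-T,-X,-Y)$ and $\phi^2=(Y,X,T,Z)$. For $\alpha\in\mathbf{F}_q^{4n}$, $a\in\mathbf{F}_q$,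 $l\in\{1,2\}$, define $\phi*_{l,a}\alpha=\phi-a\,\phi^l\times\alpha$, and for a subspace $N$, $N*_{l,a}\alpha=\{\phi*_{l,a}\alpha:\phi\in N\}$. -}

module Defs where

open import Level using (0ℓ)
open import Data.Nat as ℕ using (ℕ; suc)
open import Data.Nat.Primality using (Prime)
open import Data.Nat.Divisibility using (_∣_)
open import Data.Fin as Fin using (Fin)
open import Data.Vec as Vec using (Vec; zipWith; map; foldr; replicate)
open import Data.Product using (Σ; ∃; _×_; _,_)
open import Relation.Binary.PropositionalEquality using (_≡_)
open import Relation.Nullary using (¬_)
open import Relation.Unary using (Pred)
open import Algebra.Structures using (IsCommutativeRing)
open import Function.Bundles using (_↔_)

record FiniteField (q : ℕ) : Set₁ where
  infixl 7 _*_
  infixl 6 _+_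
  field
    Carrier : Set
    _+_ _*_ : Carrier → Carrier → Carrier
    -_      : Carrier → Carrier
    0# 1#   : Carrier
    isCommutativeRing : IsCommutativeRing _≡_ _+_ _*_ -_ 0# 1#
    0≢1     : ¬ (0# ≡ 1#)
    inverse : ∀ x → ¬ (x ≡ 0#) → Σ Carrier (λ y → x * y ≡ 1#)
    card    : Carrier ↔ Fin q

OddPrimePower : ℕ → Set
OddPrimePower q = Σ ℕ λ p → Σ ℕ λ k → Prime p × ¬ (2 ∣ p) × q ≡ p ℕ.^ suc k

module Space {q : ℕ} (F : FiniteField q) (n : ℕ) where
  open FiniteField F

  Vn : Set
  Vn = Vec Carrier n

  record V4 : Set where
    constructor ⟨_,_,_,_⟩
    field X Y Z T : Vn
  open V4 public

  _×ₙ_ : Vn → Vn → Vn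
  u ×ₙ v = zipWith _*_ u v

  negₙ : Vn → Vn
  negₙ = map -_

  _-ₙ_ : Vn → Vn → Vn
  u -ₙ v = zipWith (λ x y → x + - y) u v

  scaleₙ : Carrier → Vn → Vn
  scaleₙ a = map (a *_)

  dotₙ : Vn → Vn → Carrier
  dotₙ u v = foldr _ _+_ 0# (zipWith _*_ u v)

  _⊗_ : V4 → V4 → V4
  φ ⊗ ψ = ⟨ X φ ×ₙ X ψ , Y φ ×ₙ Y ψ , Z φ ×ₙ Z ψ , T φ ×ₙ T ψ ⟩

  _⊕_ : V4 → V4 → V4
  φ ⊕ ψ = ⟨ zipWith _+_ (X φ) (X ψ) , zipWith _+_ (Y φ) (Y ψ)
          , zipWith _+_ (Z φ) (Z ψ) , zipWith _+_ (T φ) (T ψ) ⟩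

  _⊖_ : V4 → V4 → V4
  φ ⊖ ψ = ⟨ X φ -ₙ X ψ , Y φ -ₙ Y ψ , Z φ -ₙ Z ψ , T φ -ₙ T ψ ⟩

  _·_ : Carrier → V4 → V4
  a · φ = ⟨ scaleₙ a (X φ) , scaleₙ a (Y φ) , scaleₙ a (Z φ) , scaleₙ a (T φ) ⟩

  zero4 : V4
  zero4 = ⟨ replicate n 0# , replicate n 0#
          , replicate n 0# , replicate n 0# ⟩

  form : V4 → V4 → Carrier
  form φ ψ = dotₙ (X φ) (X ψ) + - dotₙ (Y φ) (Y ψ)
           + dotₙ (Z φ) (Z ψ) + - dotₙ (T φ) (T ψ)

  sup1 : V4 → V4
  sup1 φ = ⟨ negₙ (Z φ) , negₙ (T φ) , negₙ (X φ) , negₙ (Y φ) ⟩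

  sup2 : V4 → V4
  sup2 φ = ⟨ Y φ , X φ , T φ , Z φ ⟩

  -- l ∈ {1,2}, encoded as Fin 2 (zero ↦ 1, suc zero ↦ 2)
  sup : Fin 2 → V4 → V4
  sup Fin.zero       = sup1
  sup (Fin.suc _)    = sup2

  star : Fin 2 → Carrier → V4 → V4 → V4
  star l a α φ = φ ⊖ (a · (sup l φ ⊗ α))

  record Subspace : Set₁ where
    field
      mem     : Pred V4 0ℓ
      0∈      : mem zero4
      +-closed : ∀ {φ ψ} → mem φ → mem ψ → mem (φ ⊕ ψ)
      ·-closed : ∀ a {φ} → mem φ → mem (a · φ)

  starSet : Fin 2 → Carrier → V4 → Pred V4 0ℓ → Pred V4 0ℓ
  starSet l a α N ψ = Σ V4 λ φ → N φ × ψ ≡ star l a α φ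

  perp : Pred V4 0ℓ → Pred V4 0ℓ
  perp N ψ = ∀ φ → N φ → form φ ψ ≡ 0#

{-# OPTIONS --safe #-}
-- Everything happens coordinatewise, and the coordinates of φ *_{l,a} α split into pairs
-- (X, Z), (Y, T) for l = 1 and (X, Y), (Z, T) for l = 2, each twisted by the other one
-- of its pair.  On a pair, undoing the twist by a with the twist by -a, or pairing a
-- twist by α with a twist by α^l in the form, reproduces the old value up to a multiple
-- of a product of two coordinates of α that vanishes because α × α^l = 0.  So *_{l,-a} α
-- inverts *_{l,a} α, and (iii) follows from (ii) because α^l again satisfies
-- α^l × (α^l)^l = 0, which makes *_{l,a} α^l onto.
module Submission where

open import Defs
open import Algebra.Bundles using (CommutativeRing; RawRing)
open import Data.Fin using (Fin; zero; suc)
open import Data.Maybe using (Maybe; just; nothing)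
open import Data.Nat as ℕ using (ℕ; zero; suc; _≤_; _∸_)
open import Data.Nat.Properties using (+-suc)
open import Data.Product using (Σ; _×_; _,_)
open import Data.Vec using ([]; _∷_)
open import Function using (id)
open import Function.Definitions using (Bijective)
open import Function.Consequences.Propositional
  using (inverseᵇ⇒bijective; strictlyInverseˡ⇒inverseˡ; strictlyInverseʳ⇒inverseʳ)
open import Level using (0ℓ)
open import Relation.Binary.PropositionalEquality as ≡ using (_≡_)
open import Relation.Nullary using (yes; no)
open import Relation.Unary using (Pred; _⊆_; _≐_)

module IntegerCoefficientSolver {c ℓ} (R : CommutativeRing c ℓ) where
  open CommutativeRing R
  open import Algebra.Properties.Ring ring
    using (-‿+-comm; ⁻¹-anti-homo‿-; x[y-z]≈xy-xz; [y-z]x≈yx-zx; -0#≈0#)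
  open import Algebra.Properties.CommutativeSemigroup +-commutativeSemigroup
    using (interchange)
  open import Algebra.Properties.Semiring.Mult semiring
    using (×-homo-0; ×-homo-1; ×-homo-+; ×1-homo-*) renaming (_×_ to _×ᵤ_)
  open import Algebra.Solver.Ring.AlmostCommutativeRing
    using (fromCommutativeRing; _-Raw-AlmostCommutative⟶_)
  open import Relation.Binary.Reasoning.Setoid setoid

  private
    [a+b]-[c+d]≈[a-c]+[b-d] : ∀ a b c d → (a + b) - (c + d) ≈ (a - c) + (b - d)
    [a+b]-[c+d]≈[a-c]+[b-d] a b c d = begin
      (a + b) - (c + d)       ≈⟨ +-congˡ (-‿+-comm c d) ⟨
      (a + b) + (- c + - d)   ≈⟨ interchange a b (- c) (- d) ⟩
      (a - c) + (b - d)       ∎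

    [a+c]-[b+c]≈a-b : ∀ a b c → (a + c) - (b + c) ≈ a - b
    [a+c]-[b+c]≈a-b a b c = begin
      (a + c) - (b + c)    ≈⟨ [a+b]-[c+d]≈[a-c]+[b-d] a c b c ⟩
      (a - b) + (c - c)    ≈⟨ +-congˡ (-‿inverseʳ c) ⟩
      (a - b) + 0#         ≈⟨ +-identityʳ _ ⟩
      a - b                ∎

    a+b′≈a′+b⇒a-b≈a′-b′ : ∀ {a b a′ b′} → a + b′ ≈ a′ + b → a - b ≈ a′ - b′
    a+b′≈a′+b⇒a-b≈a′-b′ {a} {b} {a′} {b′} e = begin
      a - b                ≈⟨ [a+c]-[b+c]≈a-b a b b′ ⟨
      (a + b′) - (b + b′)  ≈⟨ +-congʳ e ⟩
      (a′ + b) - (b + b′)  ≈⟨ +-congˡ (-‿cong (+-comm b b′)) ⟩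
      (a′ + b) - (b′ + b)  ≈⟨ [a+c]-[b+c]≈a-b a′ b′ b ⟩
      a′ - b′              ∎

    [aa′+bb′]-[ab′+ba′]≈[a-b][a′-b′] : ∀ a b a′ b′ →
      (a * a′ + b * b′) - (a * b′ + b * a′) ≈ (a - b) * (a′ - b′)
    [aa′+bb′]-[ab′+ba′]≈[a-b][a′-b′] a b a′ b′ = begin
      (a * a′ + b * b′) - (a * b′ + b * a′)  ≈⟨ [a+b]-[c+d]≈[a-c]+[b-d] _ _ _ _ ⟩
      (a * a′ - a * b′) + (b * b′ - b * a′)  ≈⟨ +-congˡ (⁻¹-anti-homo‿- (b * a′) (b * b′)) ⟨
      (a * a′ - a * b′) - (b * a′ - b * b′)  ≈⟨ +-cong (x[y-z]≈xy-xz a a′ b′) (-‿cong (x[y-z]≈xy-xz b a′ b′)) ⟨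
      a * (a′ - b′) - b * (a′ - b′)          ≈⟨ [y-z]x≈yx-zx (a′ - b′) a b ⟨
      (a - b) * (a′ - b′)                    ∎

    m∸n+n≡m+[n∸m] : ∀ m n → m ∸ n ℕ.+ n ≡ m ℕ.+ (n ∸ m)
    m∸n+n≡m+[n∸m] zero    zero    = ≡.refl
    m∸n+n≡m+[n∸m] zero    (suc n) = ≡.refl
    m∸n+n≡m+[n∸m] (suc m) zero    = ≡.refl
    m∸n+n≡m+[n∸m] (suc m) (suc n) = ≡.trans (+-suc (m ∸ n) n) (≡.cong suc (m∸n+n≡m+[n∸m] m n))

    -- A pair (m , n) stands for the integer m - n.  Results are kept with one entry 0,
    -- because the solver compares normal forms up to definitional equality.
    canonical : ℕ × ℕ → ℕ × ℕ
    canonical (m , n) = m ∸ n , n ∸ m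

    ℤ-pairs : RawRing 0ℓ 0ℓ
    ℤ-pairs = record
      { Carrier = ℕ × ℕ
      ; _≈_     = _≡_
      ; _+_     = λ (m , n) (m′ , n′) → canonical (m ℕ.+ m′ , n ℕ.+ n′)
      ; _*_     = λ (m , n) (m′ , n′) → canonical (m ℕ.* m′ ℕ.+ n ℕ.* n′ , m ℕ.* n′ ℕ.+ n ℕ.* m′)
      ; -_      = λ (m , n) → n , m
      ; 0#      = 0 , 0
      ; 1#      = 1 , 0
      }

    ι : ℕ → Carrier
    ι k = k ×ᵤ 1#

    ⟦_⟧ᶜ : ℕ × ℕ → Carrier
    ⟦ m , n ⟧ᶜ = ι m - ι n

    ⟦⟧ᶜ-cross : ∀ m n m′ n′ → m ℕ.+ n′ ≡ m′ ℕ.+ n → ⟦ m , n ⟧ᶜ ≈ ⟦ m′ , n′ ⟧ᶜ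
    ⟦⟧ᶜ-cross m n m′ n′ e = a+b′≈a′+b⇒a-b≈a′-b′ (begin
      ι m + ι n′      ≈⟨ ×-homo-+ 1# m n′ ⟨
      ι (m ℕ.+ n′)    ≡⟨ ≡.cong ι e ⟩
      ι (m′ ℕ.+ n)    ≈⟨ ×-homo-+ 1# m′ n ⟩
      ι m′ + ι n      ∎)

    ⟦canonical⟧ : ∀ m n → ⟦ canonical (m , n) ⟧ᶜ ≈ ⟦ m , n ⟧ᶜ
    ⟦canonical⟧ m n = ⟦⟧ᶜ-cross _ _ m n (m∸n+n≡m+[n∸m] m n)

    ι-+-* : ∀ m m′ n n′ → ι (m ℕ.* m′ ℕ.+ n ℕ.* n′) ≈ ι m * ι m′ + ι n * ι n′
    ι-+-* m m′ n n′ = trans (×-homo-+ 1# (m ℕ.* m′) (n ℕ.* n′)) (+-cong (×1-homo-* m m′) (×1-homo-* n n′))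

    ⟦⟧ᶜ-homomorphism : ℤ-pairs -Raw-AlmostCommutative⟶ fromCommutativeRing R
    ⟦⟧ᶜ-homomorphism = record
      { ⟦_⟧    = ⟦_⟧ᶜ
      ; +-homo = λ (m , n) (m′ , n′) → begin
          ⟦ canonical (m ℕ.+ m′ , n ℕ.+ n′) ⟧ᶜ  ≈⟨ ⟦canonical⟧ (m ℕ.+ m′) (n ℕ.+ n′) ⟩
          ι (m ℕ.+ m′) - ι (n ℕ.+ n′)          ≈⟨ +-cong (×-homo-+ 1# m m′) (-‿cong (×-homo-+ 1# n n′)) ⟩
          (ι m + ι m′) - (ι n + ι n′)          ≈⟨ [a+b]-[c+d]≈[a-c]+[b-d] _ _ _ _ ⟩
          ⟦ m , n ⟧ᶜ + ⟦ m′ , n′ ⟧ᶜ             ∎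
      ; *-homo = λ (m , n) (m′ , n′) → begin
          ⟦ canonical (m ℕ.* m′ ℕ.+ n ℕ.* n′ , m ℕ.* n′ ℕ.+ n ℕ.* m′) ⟧ᶜ
            ≈⟨ ⟦canonical⟧ (m ℕ.* m′ ℕ.+ n ℕ.* n′) (m ℕ.* n′ ℕ.+ n ℕ.* m′) ⟩
          ι (m ℕ.* m′ ℕ.+ n ℕ.* n′) - ι (m ℕ.* n′ ℕ.+ n ℕ.* m′)
            ≈⟨ +-cong (ι-+-* m m′ n n′) (-‿cong (ι-+-* m n′ n m′)) ⟩
          (ι m * ι m′ + ι n * ι n′) - (ι m * ι n′ + ι n * ι m′)
            ≈⟨ [aa′+bb′]-[ab′+ba′]≈[a-b][a′-b′] _ _ _ _ ⟩
          ⟦ m , n ⟧ᶜ * ⟦ m′ , n′ ⟧ᶜ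
            ∎
      ; -‿homo = λ (m , n) → sym (⁻¹-anti-homo‿- (ι m) (ι n))
      ; 0-homo = -‿inverseʳ 0#
      ; 1-homo = begin
          ι 1 - ι 0  ≈⟨ +-cong (×-homo-1 1#) (-‿cong (×-homo-0 1#)) ⟩
          1# - 0#    ≈⟨ +-congˡ -0#≈0# ⟩
          1# + 0#    ≈⟨ +-identityʳ 1# ⟩
          1#         ∎
      }

    ⟦⟧ᶜ-dec : ∀ p p′ → Maybe (⟦ p ⟧ᶜ ≈ ⟦ p′ ⟧ᶜ)
    ⟦⟧ᶜ-dec (m , n) (m′ , n′) with m ℕ.+ n′ ℕ.≟ m′ ℕ.+ n
    ... | yes e = just (⟦⟧ᶜ-cross m n m′ n′ e)
    ... | no _  = nothing

  open import Algebra.Solver.Ring ℤ-pairs (fromCommutativeRing R) ⟦⟧ᶜ-homomorphism ⟦⟧ᶜ-dec public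

module StarOperation {q : ℕ} (F : FiniteField q) where
  open FiniteField F
  open ≡ using (refl; sym; trans; cong; cong₂; subst; module ≡-Reasoning)
  private module Sp {m : ℕ} = Space F m
  open Sp
  open ≡-Reasoning

  commutativeRing : CommutativeRing 0ℓ 0ℓ
  commutativeRing = record { isCommutativeRing = isCommutativeRing }

  open CommutativeRing commutativeRing using (_-_; zeroˡ; +-identityʳ)
  open import Algebra.Properties.Ring (CommutativeRing.ring commutativeRing) using (-‿involutive)
  open IntegerCoefficientSolver commutativeRing using (solve; _:=_; _:+_; _:-_; _:*_; :-_)

  +-absorbs-0* : ∀ {x p} k → p ≡ 0# → x + p * k ≡ x
  +-absorbs-0* {x} k refl = trans (cong (x +_) (zeroˡ k)) (+-identityʳ x)

  -- Each coordinate of φ^l is ± the coordinate of φ paired with it, the pairs being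
  -- (X, Z), (Y, T) for l = 1 and (X, Y), (Z, T) for l = 2; this is the sign.
  supSign : Fin 2 → Carrier → Carrier
  supSign zero    = -_
  supSign (suc _) = id

  -- A coordinate of φ *_{l,a} α, where u is the coordinate of φ, v the one paired
  -- with it and A the corresponding coordinate of α.
  starᶜ : Fin 2 → Carrier → Carrier → Carrier → Carrier → Carrier
  starᶜ l a A u v = u - a * (supSign l v * A)

  starᶜ-inverse : ∀ l a A C u v → A * supSign l C ≡ 0# →
                  starᶜ l a A (starᶜ l (- a) A u v) (starᶜ l (- a) C v u) ≡ u
  starᶜ-inverse zero a A C u v AC≡0 = trans
    (solve 5 (λ a A C u v →
       (u :- :- a :* (:- v :* A)) :- a :* (:- (v :- :- a :* (:- u :* C)) :* A)
       := u :+ (A :* :- C) :* (a :* a :* u)) refl a A C u v)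
    (+-absorbs-0* (a * a * u) AC≡0)
  starᶜ-inverse (suc _) a A C u v AC≡0 = trans
    (solve 5 (λ a A C u v →
       (u :- :- a :* (v :* A)) :- a :* ((v :- :- a :* (u :* C)) :* A)
       := u :+ (A :* C) :* :- (a :* a :* u)) refl a A C u v)
    (+-absorbs-0* (- (a * a * u)) AC≡0)

  starᶜ-isometry₁ : ∀ a A C u v u′ v′ → A * - C ≡ 0# →
    starᶜ zero a A u v * starᶜ zero a (- C) u′ v′ + starᶜ zero a C v u * starᶜ zero a (- A) v′ u′
    ≡ u * u′ + v * v′
  starᶜ-isometry₁ a A C u v u′ v′ AC≡0 = trans
    (solve 7 (λ a A C u v u′ v′ →
       (u :- a :* (:- v :* A)) :* (u′ :- a :* (:- v′ :* :- C))
         :+ (v :- a :* (:- u :* C)) :* (v′ :- a :* (:- u′ :* :- A))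
       := (u :* u′ :+ v :* v′) :+ (A :* :- C) :* (a :* a :* (u :* u′ :+ v :* v′))) refl a A C u v u′ v′)
    (+-absorbs-0* (a * a * (u * u′ + v * v′)) AC≡0)

  starᶜ-isometry₂ : ∀ a A B u v u′ v′ → A * B ≡ 0# →
    starᶜ (suc zero) a A u v * starᶜ (suc zero) a B u′ v′
      - starᶜ (suc zero) a B v u * starᶜ (suc zero) a A v′ u′
    ≡ u * u′ - v * v′
  starᶜ-isometry₂ a A B u v u′ v′ AB≡0 = trans
    (solve 7 (λ a A B u v u′ v′ →
       (u :- a :* (v :* A)) :* (u′ :- a :* (v′ :* B)) :- (v :- a :* (u :* B)) :* (v′ :- a :* (u′ :* A))
       := (u :* u′ :- v :* v′) :+ (A :* B) :* (a :* a :* (v :* v′ :- u :* u′))) refl a A B u v u′ v′)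
    (+-absorbs-0* (a * a * (v * v′ - u * u′)) AB≡0)

  ⟨∷⟩-injective : ∀ {m} {x y z t x′ y′ z′ t′} {xs ys zs ts xs′ ys′ zs′ ts′ : Vn {m}} →
    ⟨ x ∷ xs , y ∷ ys , z ∷ zs , t ∷ ts ⟩ ≡ ⟨ x′ ∷ xs′ , y′ ∷ ys′ , z′ ∷ zs′ , t′ ∷ ts′ ⟩ →
    x ≡ x′ × y ≡ y′ × z ≡ z′ × t ≡ t′ × ⟨ xs , ys , zs , ts ⟩ ≡ ⟨ xs′ , ys′ , zs′ , ts′ ⟩
  ⟨∷⟩-injective refl = refl , refl , refl , refl , refl

  ⟨∷⟩-cong : ∀ {m} {x y z t x′ y′ z′ t′} {xs ys zs ts xs′ ys′ zs′ ts′ : Vn {m}} →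
    x ≡ x′ → y ≡ y′ → z ≡ z′ → t ≡ t′ → ⟨ xs , ys , zs , ts ⟩ ≡ ⟨ xs′ , ys′ , zs′ , ts′ ⟩ →
    ⟨ x ∷ xs , y ∷ ys , z ∷ zs , t ∷ ts ⟩ ≡ ⟨ x′ ∷ xs′ , y′ ∷ ys′ , z′ ∷ zs′ , t′ ∷ ts′ ⟩
  ⟨∷⟩-cong refl refl refl refl refl = refl

  star-inverse : ∀ {m} l a (α φ : V4 {m}) → α ⊗ sup l α ≡ zero4 →
                 star l a α (star l (- a) α φ) ≡ φ
  star-inverse zero    _ ⟨ [] , [] , [] , [] ⟩ ⟨ [] , [] , [] , [] ⟩ _ = refl
  star-inverse (suc _) _ ⟨ [] , [] , [] , [] ⟩ ⟨ [] , [] , [] , [] ⟩ _ = refl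
  star-inverse zero a ⟨ A ∷ As , B ∷ Bs , C ∷ Cs , D ∷ Ds ⟩ ⟨ x ∷ xs , y ∷ ys , z ∷ zs , t ∷ ts ⟩ h =
    let hA , hB , hC , hD , h′ = ⟨∷⟩-injective h in
    ⟨∷⟩-cong (starᶜ-inverse zero a A C x z hA) (starᶜ-inverse zero a B D y t hB)
             (starᶜ-inverse zero a C A z x hC) (starᶜ-inverse zero a D B t y hD)
             (star-inverse zero a ⟨ As , Bs , Cs , Ds ⟩ ⟨ xs , ys , zs , ts ⟩ h′)
  star-inverse (suc k) a ⟨ A ∷ As , B ∷ Bs , C ∷ Cs , D ∷ Ds ⟩ ⟨ x ∷ xs , y ∷ ys , z ∷ zs , t ∷ ts ⟩ h =
    let hA , hB , hC , hD , h′ = ⟨∷⟩-injective h in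
    ⟨∷⟩-cong (starᶜ-inverse (suc k) a A B x y hA) (starᶜ-inverse (suc k) a B A y x hB)
             (starᶜ-inverse (suc k) a C D z t hC) (starᶜ-inverse (suc k) a D C t z hD)
             (star-inverse (suc k) a ⟨ As , Bs , Cs , Ds ⟩ ⟨ xs , ys , zs , ts ⟩ h′)

  star-bijective : ∀ {m} l a (α : V4 {m}) → α ⊗ sup l α ≡ zero4 → Bijective _≡_ _≡_ (star l a α)
  star-bijective l a α h = inverseᵇ⇒bijective
    ( strictlyInverseˡ⇒inverseˡ (star l a α) (λ φ → star-inverse l a α φ h)
    , strictlyInverseʳ⇒inverseʳ (star l a α) star⁻¹∘star )
    where
    star⁻¹∘star : ∀ φ → star l (- a) α (star l a α φ) ≡ φ
    star⁻¹∘star φ = subst (λ b → star l (- a) α (star l b α φ) ≡ φ) (-‿involutive a)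
                          (star-inverse l (- a) α φ h)

  sup-orthogonal : ∀ {m} l (α : V4 {m}) → α ⊗ sup l α ≡ zero4 → sup l α ⊗ sup l (sup l α) ≡ zero4
  sup-orthogonal zero ⟨ [] , [] , [] , [] ⟩ _ = refl
  sup-orthogonal zero ⟨ A ∷ As , B ∷ Bs , C ∷ Cs , D ∷ Ds ⟩ h =
    let hA , hB , hC , hD , h′ = ⟨∷⟩-injective h in
    ⟨∷⟩-cong (trans (-x*-y≡x*y C (- A)) hC) (trans (-x*-y≡x*y D (- B)) hD)
             (trans (-x*-y≡x*y A (- C)) hA) (trans (-x*-y≡x*y B (- D)) hB)
             (sup-orthogonal zero ⟨ As , Bs , Cs , Ds ⟩ h′)
    where
    -x*-y≡x*y : ∀ x y → - x * - y ≡ x * y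
    -x*-y≡x*y = solve 2 (λ x y → :- x :* :- y := x :* y) refl
  sup-orthogonal (suc _) α h = cong sup2 h

  p-q+r-s≡[p+r]-[q+s] : ∀ p q r s → p - q + r - s ≡ (p + r) - (q + s)
  p-q+r-s≡[p+r]-[q+s] = solve 4 (λ p q r s → p :- q :+ r :- s := (p :+ r) :- (q :+ s)) refl

  p-q+r-s≡[p-q]+[r-s] : ∀ p q r s → p - q + r - s ≡ (p - q) + (r - s)
  p-q+r-s≡[p-q]+[r-s] = solve 4 (λ p q r s → p :- q :+ r :- s := (p :- q) :+ (r :- s)) refl

  form-∷ : ∀ {m} {x y z t x′ y′ z′ t′} (φ ψ : V4 {m}) →
    form ⟨ x ∷ X φ , y ∷ Y φ , z ∷ Z φ , t ∷ T φ ⟩ ⟨ x′ ∷ X ψ , y′ ∷ Y ψ , z′ ∷ Z ψ , t′ ∷ T ψ ⟩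
    ≡ (x * x′ - y * y′ + z * z′ - t * t′) + form φ ψ
  form-∷ _ _ = solve 8 (λ p q r s d₁ d₂ d₃ d₄ →
    (p :+ d₁) :- (q :+ d₂) :+ (r :+ d₃) :- (s :+ d₄) := (p :- q :+ r :- s) :+ (d₁ :- d₂ :+ d₃ :- d₄))
    refl _ _ _ _ _ _ _ _

  form-∷-cong : ∀ {m} {x₁ y₁ z₁ t₁ x₁′ y₁′ z₁′ t₁′ x y z t x′ y′ z′ t′} (φ₁ ψ₁ φ ψ : V4 {m}) →
    x₁ * x₁′ - y₁ * y₁′ + z₁ * z₁′ - t₁ * t₁′ ≡ x * x′ - y * y′ + z * z′ - t * t′ →
    form φ₁ ψ₁ ≡ form φ ψ →
    form ⟨ x₁ ∷ X φ₁ , y₁ ∷ Y φ₁ , z₁ ∷ Z φ₁ , t₁ ∷ T φ₁ ⟩ ⟨ x₁′ ∷ X ψ₁ , y₁′ ∷ Y ψ₁ , z₁′ ∷ Z ψ₁ , t₁′ ∷ T ψ₁ ⟩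
    ≡ form ⟨ x ∷ X φ , y ∷ Y φ , z ∷ Z φ , t ∷ T φ ⟩ ⟨ x′ ∷ X ψ , y′ ∷ Y ψ , z′ ∷ Z ψ , t′ ∷ T ψ ⟩
  form-∷-cong φ₁ ψ₁ φ ψ heads tails =
    trans (form-∷ φ₁ ψ₁) (trans (cong₂ _+_ heads tails) (sym (form-∷ φ ψ)))

  form-star : ∀ {m} l a (α φ ψ : V4 {m}) → α ⊗ sup l α ≡ zero4 →
              form (star l a α φ) (star l a (sup l α) ψ) ≡ form φ ψ
  form-star zero    _ ⟨ [] , [] , [] , [] ⟩ ⟨ [] , [] , [] , [] ⟩ ⟨ [] , [] , [] , [] ⟩ _ = refl
  form-star (suc _) _ ⟨ [] , [] , [] , [] ⟩ ⟨ [] , [] , [] , [] ⟩ ⟨ [] , [] , [] , [] ⟩ _ = refl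
  form-star zero a ⟨ A ∷ As , B ∷ Bs , C ∷ Cs , D ∷ Ds ⟩ ⟨ x ∷ xs , y ∷ ys , z ∷ zs , t ∷ ts ⟩
            ⟨ x′ ∷ xs′ , y′ ∷ ys′ , z′ ∷ zs′ , t′ ∷ ts′ ⟩ h =
    let hA , hB , _ , _ , h′ = ⟨∷⟩-injective h
        α′ = ⟨ As , Bs , Cs , Ds ⟩; φ′ = ⟨ xs , ys , zs , ts ⟩; ψ′ = ⟨ xs′ , ys′ , zs′ , ts′ ⟩
    in form-∷-cong (star zero a α′ φ′) (star zero a (sup zero α′) ψ′) φ′ ψ′
         (trans (p-q+r-s≡[p+r]-[q+s] _ _ _ _)
           (trans (cong₂ _-_ (starᶜ-isometry₁ a A C x z x′ z′ hA) (starᶜ-isometry₁ a B D y t y′ t′ hB))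
             (sym (p-q+r-s≡[p+r]-[q+s] _ _ _ _))))
         (form-star zero a α′ φ′ ψ′ h′)
  form-star (suc k) a ⟨ A ∷ As , B ∷ Bs , C ∷ Cs , D ∷ Ds ⟩ ⟨ x ∷ xs , y ∷ ys , z ∷ zs , t ∷ ts ⟩
            ⟨ x′ ∷ xs′ , y′ ∷ ys′ , z′ ∷ zs′ , t′ ∷ ts′ ⟩ h =
    let hA , _ , hC , _ , h′ = ⟨∷⟩-injective h
        α′ = ⟨ As , Bs , Cs , Ds ⟩; φ′ = ⟨ xs , ys , zs , ts ⟩; ψ′ = ⟨ xs′ , ys′ , zs′ , ts′ ⟩
    in form-∷-cong (star (suc k) a α′ φ′) (star (suc k) a (sup (suc k) α′) ψ′) φ′ ψ′
         (trans (p-q+r-s≡[p-q]+[r-s] _ _ _ _)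
           (trans (cong₂ _+_ (starᶜ-isometry₂ a A B x y x′ y′ hA) (starᶜ-isometry₂ a C D z t z′ t′ hC))
             (sym (p-q+r-s≡[p-q]+[r-s] _ _ _ _))))
         (form-star (suc k) a α′ φ′ ψ′ h′)

  image : ∀ {m} → (V4 {m} → V4 {m}) → Pred (V4 {m}) 0ℓ → Pred (V4 {m}) 0ℓ
  image f N ψ = Σ V4 λ φ → N φ × ψ ≡ f φ

  perp-image : ∀ {m} (f g g⁻¹ : V4 {m} → V4 {m}) →
               (∀ φ ψ → form (f φ) (g ψ) ≡ form φ ψ) → (∀ ψ → g (g⁻¹ ψ) ≡ ψ) →
               ∀ N → perp (image f N) ≐ image g (perp N)
  perp-image f g g⁻¹ f-g-isometry g∘g⁻¹ N = perp-fN⊆g-perpN , g-perpN⊆perp-fN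
    where
    perp-fN⊆g-perpN : perp (image f N) ⊆ image g (perp N)
    perp-fN⊆g-perpN {ψ} ψ⊥fN = g⁻¹ ψ , g⁻¹ψ⊥N , sym (g∘g⁻¹ ψ)
      where
      g⁻¹ψ⊥N : perp N (g⁻¹ ψ)
      g⁻¹ψ⊥N φ Nφ = begin
        form φ (g⁻¹ ψ)            ≡⟨ f-g-isometry φ (g⁻¹ ψ) ⟨
        form (f φ) (g (g⁻¹ ψ))    ≡⟨ cong (form (f φ)) (g∘g⁻¹ ψ) ⟩
        form (f φ) ψ              ≡⟨ ψ⊥fN (f φ) (φ , Nφ , refl) ⟩
        0#                        ∎
    g-perpN⊆perp-fN : image g (perp N) ⊆ perp (image f N)
    g-perpN⊆perp-fN (ψ , ψ⊥N , refl) _ (φ , Nφ , refl) = trans (f-g-isometry φ ψ) (ψ⊥N φ Nφ)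

mainTheorem3 : ∀ {q : ℕ} (F : FiniteField q) → OddPrimePower q →
    (n : ℕ) → 1 ≤ n →
    let open FiniteField F
        open Space F n
    in (l : Fin 2) (a : Carrier) (α : V4) →
       α ⊗ sup1 α ≡ zero4 → α ⊗ sup2 α ≡ zero4 →
       -- (i)
       Bijective _≡_ _≡_ (star l a α)
       -- (ii)
       × (∀ φ ψ → form (star l a α φ) (star l a (sup l α) ψ) ≡ form φ ψ)
       -- (iii)
       × (∀ (N : Subspace) ψ →
            (perp (starSet l a α (Subspace.mem N)) ψ
               → starSet l a (sup l α) (perp (Subspace.mem N)) ψ)
          × (starSet l a (sup l α) (perp (Subspace.mem N)) ψ
               → perp (starSet l a α (Subspace.mem N)) ψ))
mainTheorem3 F _ n _ l a α α⊥α¹ α⊥α² =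
    star-bijective l a α (α⊥α^ l)
  , isometry
  , λ N _ → let ⊆ , ⊇ = perp-image (star l a α) (star l a (sup l α)) (star l (- a) (sup l α))
                                   isometry αˡ-inverse (Subspace.mem N)
            in ⊆ , ⊇
  where
  open FiniteField F
  open Space F n
  open StarOperation F

  α⊥α^ : ∀ k → α ⊗ sup k α ≡ zero4
  α⊥α^ zero    = α⊥α¹
  α⊥α^ (suc _) = α⊥α²

  isometry : ∀ φ ψ → form (star l a α φ) (star l a (sup l α) ψ) ≡ form φ ψ
  isometry φ ψ = form-star l a α φ ψ (α⊥α^ l)

  αˡ-inverse : ∀ ψ → star l a (sup l α) (star l (- a) (sup l α) ψ) ≡ ψ
  αˡ-inverse ψ = star-inverse l a (sup l α) ψ (sup-orthogonal l α (α⊥α^ l))
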